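{- Let $\sigma$ be the morphism on $\{0,1,2\}^*$ defined by $\sigma(0)=01$, $\sigma(1)=12$, $\sigma(2)=20$, and let $\mathbf{t}=\sigma^{\infty}(0)$ be its fixed point starting with $0$. For $c\in\{0,1,2\}$ let $\tau_c$ be the morphism on $\{0,1,2\}^*$ that fixes $c$ and exchanges the two other letters. If $u$ is a factor of $\mathbf{t}$, then $\tau_c(u)^R$ is a factor of $\mathbf{t}$ for each $c\in\{0,1,2\}$.
   Context: For a finite word $w=w_0w_1\cdots w_n$, its mirror is $w^R=w_nw_{n-1}\cdots w_0$. -}

module Defs where

open import Data.Nat using (ℕ; zero; suc; _+_)
open import Data.Fin using (Fin; zero; suc)
open import Data.List using (List; []; _∷_; _++_; concatMap; map; length; reverse; applyUpTo; lookup)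
open import Data.Maybe using (Maybe; just; nothing)
open import Data.Product using (∃)
open import Relation.Binary.PropositionalEquality using (_≡_)

Letter : Set
Letter = Fin 3

extend : (Letter → List Letter) → List Letter → List Letter
extend f = concatMap f

σ₀ : Letter → List Letter
σ₀ zero = zero ∷ suc zero ∷ []
σ₀ (suc zero) = suc zero ∷ suc (suc zero) ∷ []
σ₀ (suc (suc zero)) = suc (suc zero) ∷ zero ∷ []

σ : List Letter → List Letter
σ = extend σ₀

σ^ : ℕ → List Letter → List Letter
σ^ zero w = w
σ^ (suc n) w = σ (σ^ n w)

_!!_ : List Letter → ℕ → Maybe Letter
[] !! _ = nothing
(x ∷ xs) !! zero = just x
(x ∷ xs) !! suc n = xs !! n

-- t = σ^∞(0): since σ(0) starts with 0, σ^n(0) is a prefix of σ^(n+1)(0)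
-- and |σ^n(0)| = 2^n > n, so the n-th letter of t is the n-th letter of σ^(n+1)(0).
-- (The index-out-of-range default is never used.)
t : ℕ → Letter
t n with σ^ (suc n) (zero ∷ []) !! n
... | just a = a
... | nothing = zero

factorAt : ℕ → ℕ → List Letter
factorAt i m = applyUpTo (λ j → t (i + j)) m

IsFactor : List Letter → Set
IsFactor u = ∃ λ i → factorAt i (length u) ≡ u

τ₀ : Letter → Letter → Letter
τ₀ zero zero = zero
τ₀ zero (suc zero) = suc (suc zero)
τ₀ zero (suc (suc zero)) = suc zero
τ₀ (suc zero) zero = suc (suc zero)
τ₀ (suc zero) (suc zero) = suc zero
τ₀ (suc zero) (suc (suc zero)) = zero
τ₀ (suc (suc zero)) zero = suc zero
τ₀ (suc (suc zero)) (suc zero) = zero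
τ₀ (suc (suc zero)) (suc (suc zero)) = suc (suc zero)

τ : Letter → List Letter → List Letter
τ c = extend (λ x → τ₀ c x ∷ [])

mirror : List Letter → List Letter
mirror = reverse

-- Identify the letters with ℤ/3, so that σ(a) = a (a+1).  Then the k-th letter
-- of t is s(k) mod 3, where s(k) is the number of ones in the binary expansion
-- of k, and τ_c is the reflection a ↦ 2c - a of ℤ/3.  If x + y + 1 = 2^N with
-- x, y < 2^N, then the N-bit expansions of x and y are complementary, so
-- s(x) + s(y) = N; choosing N ≡ 2c (mod 3) gives t(x) = τ_c(t(y)).  Hence
-- inside the prefix of length 2^N, reading backwards and applying τ_c maps t
-- onto itself, and the factor at position i of length m reappears, mirrored
-- and exchanged, at position 2^N - (i + m) once 2^N ≥ i + m.
module Submission where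

open import Defs
open import Data.Fin using (zero; suc)
open import Data.List using (List; []; _∷_; map; length; reverse; applyUpTo; applyDownFrom; [_])
open import Data.List.Properties
  using (concatMap-map; concatMap-pure; map-applyUpTo; reverse-applyUpTo; length-reverse; length-map)
open import Data.Maybe using (just)
import Data.Maybe as Maybe
open import Data.Nat using (ℕ; zero; suc; _+_; _∸_; _^_; _≤_; _<_; z≤n; s≤s; ⌊_/2⌋)
open import Data.Nat.Properties
  using (+-identityʳ; +-suc; +-assoc; +-mono-≤; suc-injective; ≤-trans; <⇒≤; m≤m+n; m≤n+m;
         m^n>0; m∸n+n≡m; ⌊n/2⌋-mono; n≡⌊n+n/2⌋; n≡⌈n+n/2⌉; +-commutativeSemigroup)
open import Algebra.Properties.CommutativeSemigroup +-commutativeSemigroup using (interchange)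
open import Data.Product using (_×_; _,_; ∃-syntax)
open import Function using (_∘_)
open import Relation.Binary.PropositionalEquality using (_≡_; refl; sym; trans; cong; cong₂; subst; module ≡-Reasoning)
open ≡-Reasoning

inc : Letter → Letter
inc zero = suc zero
inc (suc zero) = suc (suc zero)
inc (suc (suc zero)) = zero

inc³ : ∀ a → inc (inc (inc a)) ≡ a
inc³ zero = refl
inc³ (suc zero) = refl
inc³ (suc (suc zero)) = refl

rot : ℕ → Letter → Letter
rot zero a = a
rot (suc n) a = inc (rot n a)

rot-+ : ∀ m n a → rot (m + n) a ≡ rot m (rot n a)
rot-+ zero n a = refl
rot-+ (suc m) n a = cong inc (rot-+ m n a)

rot-above : ∀ B a → ∃[ N ] B ≤ N × rot N zero ≡ a
rot-above zero zero = 0 , z≤n , refl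
rot-above zero (suc zero) = 1 , z≤n , refl
rot-above zero (suc (suc zero)) = 2 , z≤n , refl
rot-above (suc B) a with rot-above B a
... | N , B≤N , N≡a = 3 + N , s≤s (≤-trans B≤N (m≤n+m N 2)) , trans (inc³ (rot N zero)) N≡a

τ-inc : ∀ c a → τ₀ c (inc a) ≡ inc (inc (τ₀ c a))
τ-inc zero zero = refl
τ-inc zero (suc zero) = refl
τ-inc zero (suc (suc zero)) = refl
τ-inc (suc zero) zero = refl
τ-inc (suc zero) (suc zero) = refl
τ-inc (suc zero) (suc (suc zero)) = refl
τ-inc (suc (suc zero)) zero = refl
τ-inc (suc (suc zero)) (suc zero) = refl
τ-inc (suc (suc zero)) (suc (suc zero)) = refl

-- τ_c is the reflection a ↦ 2c - a: if a + b = N and N ≡ τ_c(0) = 2c (mod 3),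
-- then a ≡ τ_c(b) (mod 3).  Induction on b, moving one unit from b to a.
τ-reflection : ∀ c N → rot N zero ≡ τ₀ c zero →
               ∀ a b → a + b ≡ N → rot a zero ≡ τ₀ c (rot b zero)
τ-reflection c N N≡2c a zero a+0≡N =
  trans (cong (λ n → rot n zero) (trans (sym (+-identityʳ a)) a+0≡N)) N≡2c
τ-reflection c N N≡2c a (suc b) a+b≡N = begin
  rot a zero                    ≡⟨ sym (inc³ (rot a zero)) ⟩
  inc (inc (rot (suc a) zero))  ≡⟨ cong (inc ∘ inc) shifted ⟩
  inc (inc (τ₀ c (rot b zero))) ≡⟨ sym (τ-inc c (rot b zero)) ⟩
  τ₀ c (rot (suc b) zero)       ∎
  where
  shifted : rot (suc a) zero ≡ τ₀ c (rot b zero)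
  shifted = τ-reflection c N N≡2c (suc a) b (trans (sym (+-suc a b)) a+b≡N)

bit : ℕ → ℕ
bit zero = 0
bit (suc zero) = 1
bit (suc (suc k)) = bit k

bits : ℕ → ℕ → ℕ
bits zero k = 0
bits (suc n) k = bit k + bits n ⌊ k /2⌋

bit-even : ∀ n → bit (n + n) ≡ 0
bit-even zero = refl
bit-even (suc n) rewrite +-suc n n = bit-even n

bit-odd : ∀ n → bit (suc (n + n)) ≡ 1
bit-odd zero = refl
bit-odd (suc n) rewrite +-suc n n = bit-odd n

2^-double : ∀ n → 2 ^ suc n ≡ 2 ^ n + 2 ^ n
2^-double n = cong (2 ^ n +_) (+-identityʳ (2 ^ n))

n<2^n : ∀ n → n < 2 ^ n
n<2^n zero = s≤s z≤n
n<2^n (suc n) = +-mono-≤ (m^n>0 2 n) (≤-trans (n<2^n n) (m≤m+n (2 ^ n) 0))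

n<2^[1+n] : ∀ n → n < 2 ^ suc n
n<2^[1+n] n = ≤-trans (n<2^n n) (m≤m+n (2 ^ n) _)

half-< : ∀ {x} n → x < 2 ^ suc n → ⌊ x /2⌋ < 2 ^ n
half-< {x} n x<2P = subst (⌊ x /2⌋ <_) (sym (n≡⌈n+n/2⌉ (2 ^ n)))
  (⌊n/2⌋-mono (s≤s (subst (x <_) (2^-double n) x<2P)))

bits-zero : ∀ n → bits n 0 ≡ 0
bits-zero zero = refl
bits-zero (suc n) = bits-zero n

bits-stable : ∀ m n x → x < 2 ^ m → x < 2 ^ n → bits m x ≡ bits n x
bits-stable zero n zero _ _ = sym (bits-zero n)
bits-stable zero n (suc x) (s≤s ()) _
bits-stable (suc m) zero zero _ _ = bits-zero (suc m)
bits-stable (suc m) zero (suc x) _ (s≤s ())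
bits-stable (suc m) (suc n) x x<2^m x<2^n =
  cong (bit x +_) (bits-stable m n ⌊ x /2⌋ (half-< m x<2^m) (half-< n x<2^n))

complement-halves : ∀ P x y → suc (x + y) ≡ P + P →
                    bit x + bit y ≡ 1 × suc (⌊ x /2⌋ + ⌊ y /2⌋) ≡ P
complement-halves zero x y ()
complement-halves (suc P) zero y e with trans (suc-injective e) (+-suc P P)
... | refl = bit-odd P , cong suc (sym (n≡⌈n+n/2⌉ P))
complement-halves (suc P) (suc zero) y e with suc-injective (trans (suc-injective e) (+-suc P P))
... | refl = cong suc (bit-even P) , cong suc (sym (n≡⌊n+n/2⌋ P))
complement-halves (suc P) (suc (suc x)) y e
  with complement-halves P x y (suc-injective (trans (suc-injective e) (+-suc P P)))
... | bits-sum , halves-sum = bits-sum , cong suc halves-sum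

bits-complement : ∀ N x y → suc (x + y) ≡ 2 ^ N → bits N x + bits N y ≡ N
bits-complement zero x y _ = refl
bits-complement (suc N) x y e
  with complement-halves (2 ^ N) x y (trans e (2^-double N))
... | bits-sum , halves-sum = begin
  (bit x + bits N ⌊ x /2⌋) + (bit y + bits N ⌊ y /2⌋)
    ≡⟨ interchange (bit x) (bits N ⌊ x /2⌋) (bit y) (bits N ⌊ y /2⌋) ⟩
  (bit x + bit y) + (bits N ⌊ x /2⌋ + bits N ⌊ y /2⌋)
    ≡⟨ cong₂ _+_ bits-sum (bits-complement N ⌊ x /2⌋ ⌊ y /2⌋ halves-sum) ⟩
  suc N ∎

σ₀-shape : ∀ a → σ₀ a ≡ a ∷ inc a ∷ []
σ₀-shape zero = refl
σ₀-shape (suc zero) = refl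
σ₀-shape (suc (suc zero)) = refl

σ-!! : ∀ w k → σ w !! k ≡ Maybe.map (rot (bit k)) (w !! ⌊ k /2⌋)
σ-!! [] k = refl
σ-!! (a ∷ w) zero rewrite σ₀-shape a = refl
σ-!! (a ∷ w) (suc zero) rewrite σ₀-shape a = refl
σ-!! (a ∷ w) (suc (suc k)) rewrite σ₀-shape a = σ-!! w k

prefix-letters : ∀ n k → k < 2 ^ n → σ^ n [ zero ] !! k ≡ just (rot (bits n k) zero)
prefix-letters zero zero _ = refl
prefix-letters zero (suc k) (s≤s ())
prefix-letters (suc n) k k<2^n = begin
  σ (σ^ n [ zero ]) !! k
    ≡⟨ σ-!! (σ^ n [ zero ]) k ⟩
  Maybe.map (rot (bit k)) (σ^ n [ zero ] !! ⌊ k /2⌋)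
    ≡⟨ cong (Maybe.map (rot (bit k))) (prefix-letters n ⌊ k /2⌋ (half-< n k<2^n)) ⟩
  just (rot (bit k) (rot (bits n ⌊ k /2⌋) zero))
    ≡⟨ cong just (sym (rot-+ (bit k) (bits n ⌊ k /2⌋) zero)) ⟩
  just (rot (bits (suc n) k) zero) ∎

-- t(x) is the letter at position x of σ^(x+1)(0), a prefix of length 2^(x+1) > x.
t-letter : ∀ x → t x ≡ rot (bits (suc x) x) zero
t-letter x with σ^ (suc x) [ zero ] !! x | prefix-letters (suc x) x (n<2^[1+n] x)
... | ._ | refl = refl

t-bits : ∀ N x → x < 2 ^ N → t x ≡ rot (bits N x) zero
t-bits N x x<2^N =
  trans (t-letter x) (cong (λ n → rot n zero) (bits-stable (suc x) N x (n<2^[1+n] x) x<2^N))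

t-reflection : ∀ c N → rot N zero ≡ τ₀ c zero →
               ∀ x y → suc (x + y) ≡ 2 ^ N → t x ≡ τ₀ c (t y)
t-reflection c N N≡2c x y e = begin
  t x                        ≡⟨ t-bits N x (subst (x <_) e (s≤s (m≤m+n x y))) ⟩
  rot (bits N x) zero        ≡⟨ τ-reflection c N N≡2c (bits N x) (bits N y) (bits-complement N x y e) ⟩
  τ₀ c (rot (bits N y) zero) ≡⟨ cong (τ₀ c) (sym (t-bits N y (subst (y <_) e (s≤s (m≤n+m y x))))) ⟩
  τ₀ c (t y)                 ∎

applyUpTo-mirror : ∀ {A : Set} (g f : ℕ → A) m →
                   (∀ k l → suc (k + l) ≡ m → g k ≡ f l) → applyUpTo g m ≡ applyDownFrom f m
applyUpTo-mirror g f zero _ = refl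
applyUpTo-mirror g f (suc m) mirrored =
  cong₂ _∷_ (mirrored 0 m refl)
            (applyUpTo-mirror (g ∘ suc) f m (λ k l e → mirrored (suc k) l (cong suc e)))

mirror-factor : ∀ c i m → ∃[ j ] factorAt j m ≡ reverse (map (τ₀ c) (factorAt i m))
mirror-factor c i m with rot-above (i + m) (τ₀ c zero)
... | N , i+m≤N , N≡2c = j , (begin
  applyUpTo (λ k → t (j + k)) m             ≡⟨ applyUpTo-mirror _ _ m symmetric ⟩
  applyDownFrom (τ₀ c ∘ t ∘ (i +_)) m       ≡⟨ sym (reverse-applyUpTo (τ₀ c ∘ t ∘ (i +_)) m) ⟩
  reverse (applyUpTo (τ₀ c ∘ t ∘ (i +_)) m) ≡⟨ cong reverse (sym (map-applyUpTo (t ∘ (i +_)) (τ₀ c) m)) ⟩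
  reverse (map (τ₀ c) (factorAt i m))       ∎)
  where
  j : ℕ
  j = 2 ^ N ∸ (i + m)

  j+[i+m]≡2^N : j + (i + m) ≡ 2 ^ N
  j+[i+m]≡2^N = m∸n+n≡m (≤-trans i+m≤N (<⇒≤ (n<2^n N)))

  symmetric : ∀ k l → suc (k + l) ≡ m → t (j + k) ≡ τ₀ c (t (i + l))
  symmetric k l k+l+1≡m = t-reflection c N N≡2c (j + k) (i + l) (begin
    suc (j + k + (i + l))   ≡⟨ cong suc (interchange j k i l) ⟩
    suc (j + i + (k + l))   ≡⟨ sym (+-suc (j + i) (k + l)) ⟩
    j + i + suc (k + l)     ≡⟨ +-assoc j i (suc (k + l)) ⟩
    j + (i + suc (k + l))   ≡⟨ cong (λ n → j + (i + n)) k+l+1≡m ⟩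
    j + (i + m)             ≡⟨ j+[i+m]≡2^N ⟩
    2 ^ N                   ∎)

τ-map : ∀ c u → τ c u ≡ map (τ₀ c) u
τ-map c u = trans (sym (concatMap-map [_] (τ₀ c) u)) (concatMap-pure (map (τ₀ c) u))

lemma3 : (u : List Letter) → IsFactor u → (c : Letter) → IsFactor (mirror (τ c u))
lemma3 u (i , at-i) c with mirror-factor c i (length u)
... | j , mirrored = j , (begin
  factorAt j (length (mirror (τ c u)))          ≡⟨ cong (factorAt j) same-length ⟩
  factorAt j (length u)                         ≡⟨ mirrored ⟩
  reverse (map (τ₀ c) (factorAt i (length u)))  ≡⟨ cong (reverse ∘ map (τ₀ c)) at-i ⟩
  reverse (map (τ₀ c) u)                        ≡⟨ cong reverse (sym (τ-map c u)) ⟩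
  mirror (τ c u)                                ∎)
  where
  same-length : length (mirror (τ c u)) ≡ length u
  same-length = trans (length-reverse (τ c u)) (trans (cong length (τ-map c u)) (length-map (τ₀ c) u))
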